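{- Let $k\in\mathbb{Z}$. For every integer $n\ge 1$, $$\frac{2}{n}\sum_{m=1}^{n}\frac{1}{m^{k-1}}S_{1}(n,m)=E_{n-1}^{(k)}(1)+E_{n-1}^{(k)}.$$
   Context: For $k\in\mathbb{Z}$ the polyexponential function is $\mathrm{Ei}_k(x)=\sum_{n=1}^{\infty}\frac{x^n}{n^k (n-1)!}$. The poly-Genocchi polynomials $G_n^{(k)}(x)$ are defined by $\frac{2\,\mathrm{Ei}_k(\log(1+t))}{e^t+1}e^{xt}=\sum_{n=0}^{\infty}G_n^{(k)}(x)\frac{t^n}{n!}$. The poly-Euler polynomials of index $k$ are $E_n^{(k)}(x)=\frac{G_{n+1}^{(k)}(x)}{n+1}$ for $n\ge 0$, and $E_n^{(k)}=E_n^{(k)}(0)$. $S_1(n,m)$ denotes the signed Stirling numbers of the first kind, given by $\frac{(\log(1+t))^m}{m!}=\sum_{n\ge m}S_1(n,m)\frac{t^n}{n!}$. -}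

module Defs where

open import Data.Nat as ℕ using (ℕ; zero; suc; _!; NonZero)
open import Data.Nat.Properties using (_!≢0; m^n≢0)
open import Data.Integer as ℤ using (ℤ; +_; -[1+_])
open import Data.Rational using (ℚ; _/_; _+_; _*_; -_; 0ℚ; 1ℚ)
open import Data.List using (List; []; _∷_; _++_; [_])

-- Formal power series over ℚ, represented by their coefficient sequences.
PS : Set
PS = ℕ → ℚ

_^ℚ_ : ℚ → ℕ → ℚ
q ^ℚ zero = 1ℚ
q ^ℚ suc n = q * (q ^ℚ n)

ℕ→ℚ : ℕ → ℚ
ℕ→ℚ n = + n / 1

inv-suc : ℕ → ℚ
inv-suc d = + 1 / suc d

inv! : ℕ → ℚ
inv! n = _/_ (+ 1) (n !) {{n !≢0}}

-- m ^ j for m ≥ 1 (m given as suc m') and j ∈ ℤ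
zpow-suc : ℕ → ℤ → ℚ
zpow-suc m' (+ j) = ℕ→ℚ (suc m' ℕ.^ j)
zpow-suc m' -[1+ j ] = _/_ (+ 1) (suc m' ℕ.^ suc j) {{m^n≢0 (suc m') (suc j)}}

Σ< : ℕ → (ℕ → ℚ) → ℚ
Σ< zero f = 0ℚ
Σ< (suc n) f = Σ< n f + f n

Σ≤ : ℕ → (ℕ → ℚ) → ℚ
Σ≤ n f = Σ< (suc n) f

_·_ : PS → PS → PS
(f · g) n = Σ≤ n (λ i → f i * g (n ℕ.∸ i))

oneS : PS
oneS zero = 1ℚ
oneS (suc n) = 0ℚ

_^S_ : PS → ℕ → PS
g ^S zero = oneS
g ^S suc m = g · (g ^S m)

-- composition f(g(t)), meaningful when g has zero constant term:
-- [t^n] f(g(t)) = Σ_{m=0}^{n} f_m [t^n] g(t)^m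
_∘S_ : PS → PS → PS
(f ∘S g) n = Σ≤ n (λ m → f m * (g ^S m) n)

_⋆_ : ℚ → PS → PS
(c ⋆ f) n = c * f n

-- log(1+t) = Σ_{n≥1} (-1)^{n+1} t^n / n
logS : PS
logS zero = 0ℚ
logS (suc n) = ((- 1ℚ) ^ℚ n) * inv-suc n

expS : ℚ → PS
expS x n = (x ^ℚ n) * inv! n

expPlusOne : PS
expPlusOne zero = 1ℚ + 1ℚ
expPlusOne (suc n) = inv! (suc n)

nth : List ℚ → ℕ → ℚ
nth [] _ = 0ℚ
nth (x ∷ xs) zero = x
nth (x ∷ xs) (suc i) = nth xs i

-- Multiplicative inverse of a power series a, given c = 1 / a₀:
-- b₀ = c,  b_n = - c Σ_{i=1}^{n} a_i b_{n-i}.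
-- invPrefix c a n is the list [b₀, …, b_n].
invPrefix : ℚ → PS → ℕ → List ℚ
invPrefix c a zero = [ c ]
invPrefix c a (suc n) =
  invPrefix c a n ++
  [ - (c * Σ< (suc n) (λ i → a (suc i) * nth (invPrefix c a n) (n ℕ.∸ i))) ]

invS : ℚ → PS → PS
invS c a n = nth (invPrefix c a n) n

-- polyexponential Ei_k(x) = Σ_{n≥1} x^n / (n^k (n-1)!)
Ei : ℤ → PS
Ei k zero = 0ℚ
Ei k (suc n) = zpow-suc n (ℤ.- k) * inv! n

genG : ℤ → ℚ → PS
genG k x = ((ℕ→ℚ 2 ⋆ (Ei k ∘S logS)) · expS x) · invS (inv-suc 1) expPlusOne

G : ℤ → ℕ → ℚ → ℚ
G k n x = ℕ→ℚ (n !) * genG k x n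

E : ℤ → ℕ → ℚ → ℚ
E k n x = G k (suc n) x * inv-suc n

-- signed Stirling numbers of the first kind:
-- (log(1+t))^m / m! = Σ_n S₁(n,m) t^n / n!
S₁ : ℕ → ℕ → ℚ
S₁ n m = ℕ→ℚ (n !) * ((logS ^S m) n * inv! m)

-- Since e^{t} + e^{0·t} = e^t + 1, the generating functions at x = 1 and x = 0 add up to
-- 2 Ei_k(log(1+t)) (e^t + 1) / (e^t + 1) = 2 Ei_k(log(1+t)) = 2 Σ_{m≥1} (log(1+t))^m / (m^k (m-1)!).
-- Comparing coefficients of t^n / n!, where (log(1+t))^m contributes m! S₁(n,m) / n!, gives the
-- identity, using m^{-k} / (m-1)! = m^{1-k} / m!.
module Submission where

open import Defs
open import Data.Nat as ℕ using (ℕ; zero; suc; _!; _∸_; _<_; _≤_; z≤n; s≤s; NonZero)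
open import Data.Nat.Properties as ℕ using (_!≢0; m^n≢0; m*n≢0)
open import Data.Integer as ℤ using (ℤ; _-_; +_; -[1+_])
open import Data.Integer.Properties as ℤ using ()
open import Data.Rational using (ℚ; _*_; _+_; _/_; 0ℚ; 1ℚ; -_; fromℚᵘ)
open import Data.Rational.Properties as ℚ using ()
open import Data.Rational.Unnormalised as ℚᵘ using (mkℚᵘ; *≡*)
open import Data.Rational.Unnormalised.Properties as ℚᵘ using ()
open import Data.Rational.Solver using (module +-*-Solver)
open import Data.List using (List; []; _∷_; _++_; [_]; length)
open import Data.List.Properties using (length-++)
open import Data.Sum using (inj₁; inj₂)
open import Relation.Binary.PropositionalEquality hiding ([_])
open ≡-Reasoning
open +-*-Solver

1/ℕ : (d : ℕ) .{{_ : NonZero d}} → ℚ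
1/ℕ d = + 1 / d

fromℚᵘ-homo-* : ∀ p q → fromℚᵘ (p ℚᵘ.* q) ≡ fromℚᵘ p * fromℚᵘ q
fromℚᵘ-homo-* p q = ℚ.toℚᵘ-injective
  (ℚᵘ.≃-trans (ℚ.toℚᵘ-fromℚᵘ (p ℚᵘ.* q))
  (ℚᵘ.≃-trans (ℚᵘ.*-cong (ℚᵘ.≃-sym (ℚ.toℚᵘ-fromℚᵘ p)) (ℚᵘ.≃-sym (ℚ.toℚᵘ-fromℚᵘ q)))
              (ℚᵘ.≃-sym (ℚ.toℚᵘ-homo-* (fromℚᵘ p) (fromℚᵘ q)))))

ℕ→ℚ-homo-* : ∀ a b → ℕ→ℚ (a ℕ.* b) ≡ ℕ→ℚ a * ℕ→ℚ b
ℕ→ℚ-homo-* a b = trans (cong (λ z → fromℚᵘ (mkℚᵘ z 0)) (ℤ.pos-* a b))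
                       (fromℚᵘ-homo-* (mkℚᵘ (+ a) 0) (mkℚᵘ (+ b) 0))

1/ℕ-homo-* : ∀ a b .{{_ : NonZero a}} .{{_ : NonZero b}} →
             1/ℕ (a ℕ.* b) {{m*n≢0 a b}} ≡ 1/ℕ a * 1/ℕ b
1/ℕ-homo-* (suc a) (suc b) =
  trans (ℚ.fromℚᵘ-cong {mkℚᵘ (+ 1) (b ℕ.+ a ℕ.* suc b)} {mkℚᵘ (+ 1) a ℚᵘ.* mkℚᵘ (+ 1) b} (*≡* refl))
        (fromℚᵘ-homo-* (mkℚᵘ (+ 1) a) (mkℚᵘ (+ 1) b))

ℕ→ℚ-*-inv-suc : ∀ d → ℕ→ℚ (suc d) * inv-suc d ≡ 1ℚ
ℕ→ℚ-*-inv-suc d =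
  trans (sym (fromℚᵘ-homo-* (mkℚᵘ (+ suc d) 0) (mkℚᵘ (+ 1) d)))
        (ℚ.fromℚᵘ-cong {mkℚᵘ (+ suc d) 0 ℚᵘ.* mkℚᵘ (+ 1) d} {ℚᵘ.1ℚᵘ} (*≡* (begin
          (+ suc d ℤ.* + 1) ℤ.* + 1  ≡⟨ trans (ℤ.*-identityʳ _) (ℤ.*-identityʳ _) ⟩
          + suc d                    ≡⟨ cong +_ (sym (ℕ.+-identityʳ (suc d))) ⟩
          + (suc d ℕ.+ 0)            ≡⟨ sym (ℤ.*-identityˡ _) ⟩
          + 1 ℤ.* + (suc d ℕ.+ 0)    ∎)))

zpow-suc-1+ : ∀ m z → zpow-suc m (+ 1 ℤ.+ z) ≡ ℕ→ℚ (suc m) * zpow-suc m z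
zpow-suc-1+ m (+ j) = ℕ→ℚ-homo-* (suc m) (suc m ℕ.^ j)
zpow-suc-1+ m -[1+ zero ] = begin
  1ℚ                                       ≡⟨ sym (ℕ→ℚ-*-inv-suc m) ⟩
  ℕ→ℚ (suc m) * inv-suc m                  ≡⟨ cong (λ d → ℕ→ℚ (suc m) * 1/ℕ (suc d)) (sym (ℕ.*-identityʳ m)) ⟩
  ℕ→ℚ (suc m) * zpow-suc m -[1+ zero ]     ∎
zpow-suc-1+ m -[1+ suc j ] = begin
  q                                    ≡⟨ sym (ℚ.*-identityˡ q) ⟩
  1ℚ * q                               ≡⟨ cong (_* q) (sym (ℕ→ℚ-*-inv-suc m)) ⟩
  (ℕ→ℚ (suc m) * inv-suc m) * q        ≡⟨ ℚ.*-assoc (ℕ→ℚ (suc m)) (inv-suc m) q ⟩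
  ℕ→ℚ (suc m) * (inv-suc m * q)        ≡⟨ cong (ℕ→ℚ (suc m) *_) (sym (1/ℕ-homo-* (suc m) (suc m ℕ.^ suc j) {{_}} {{m^n≢0 (suc m) (suc j)}})) ⟩
  ℕ→ℚ (suc m) * zpow-suc m -[1+ suc j ] ∎
  where q = 1/ℕ (suc m ℕ.^ suc j) {{m^n≢0 (suc m) (suc j)}}

zpow-suc-1+-*-inv! : ∀ m z → zpow-suc m (+ 1 ℤ.+ z) * inv! (suc m) ≡ zpow-suc m z * inv! m
zpow-suc-1+-*-inv! m z = begin
  zpow-suc m (+ 1 ℤ.+ z) * inv! (suc m)
    ≡⟨ cong₂ _*_ (zpow-suc-1+ m z) (1/ℕ-homo-* (suc m) (m !) {{_}} {{m !≢0}}) ⟩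
  (s * w) * (inv-suc m * inv! m)
    ≡⟨ solve 4 (λ a b c d → (a :* b) :* (c :* d) := b :* (a :* c) :* d) refl s w (inv-suc m) (inv! m) ⟩
  w * (s * inv-suc m) * inv! m   ≡⟨ cong (λ u → w * u * inv! m) (ℕ→ℚ-*-inv-suc m) ⟩
  w * 1ℚ * inv! m                ≡⟨ cong (_* inv! m) (ℚ.*-identityʳ w) ⟩
  w * inv! m                     ∎
  where
  s = ℕ→ℚ (suc m)
  w = zpow-suc m z

Σ<-cong : ∀ n {f g : ℕ → ℚ} → (∀ i → i < n → f i ≡ g i) → Σ< n f ≡ Σ< n g
Σ<-cong zero    f≡g = refl
Σ<-cong (suc n) f≡g = cong₂ _+_ (Σ<-cong n (λ i i<n → f≡g i (ℕ.m<n⇒m<1+n i<n))) (f≡g n ℕ.≤-refl)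

Σ<-+ : ∀ n (f g : ℕ → ℚ) → Σ< n (λ i → f i + g i) ≡ Σ< n f + Σ< n g
Σ<-+ zero    f g = refl
Σ<-+ (suc n) f g = begin
  Σ< n (λ i → f i + g i) + (f n + g n) ≡⟨ cong (_+ (f n + g n)) (Σ<-+ n f g) ⟩
  (Σ< n f + Σ< n g) + (f n + g n)
    ≡⟨ solve 4 (λ a b c d → (a :+ b) :+ (c :+ d) := (a :+ c) :+ (b :+ d)) refl (Σ< n f) (Σ< n g) (f n) (g n) ⟩
  Σ< (suc n) f + Σ< (suc n) g         ∎

Σ<-*ˡ : ∀ n c (f : ℕ → ℚ) → Σ< n (λ i → c * f i) ≡ c * Σ< n f
Σ<-*ˡ zero    c f = sym (ℚ.*-zeroʳ c)
Σ<-*ˡ (suc n) c f = trans (cong (_+ (c * f n)) (Σ<-*ˡ n c f)) (sym (ℚ.*-distribˡ-+ c (Σ< n f) (f n)))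

Σ<-head : ∀ n (f : ℕ → ℚ) → Σ< (suc n) f ≡ f 0 + Σ< n (λ i → f (suc i))
Σ<-head zero    f = trans (ℚ.+-identityˡ (f 0)) (sym (ℚ.+-identityʳ (f 0)))
Σ<-head (suc n) f = trans (cong (_+ f (suc n)) (Σ<-head n f)) (ℚ.+-assoc (f 0) _ _)

_+S_ : PS → PS → PS
(f +S g) n = f n + g n

tail : PS → PS
tail f n = f (suc n)

·-cong : ∀ n {f f′ g g′ : PS} → (∀ i → f i ≡ f′ i) → (∀ i → g i ≡ g′ i) → (f · g) n ≡ (f′ · g′) n
·-cong n f≡f′ g≡g′ = Σ<-cong (suc n) (λ i _ → cong₂ _*_ (f≡f′ i) (g≡g′ (n ∸ i)))

·-congˡ : ∀ n {f f′ : PS} (g : PS) → (∀ i → f i ≡ f′ i) → (f · g) n ≡ (f′ · g) n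
·-congˡ n g f≡f′ = ·-cong n {g = g} f≡f′ (λ _ → refl)

·-congʳ : ∀ n (f : PS) {g g′ : PS} → (∀ i → g i ≡ g′ i) → (f · g) n ≡ (f · g′) n
·-congʳ n f = ·-cong n {f = f} (λ _ → refl)

·-suc : ∀ n (f g : PS) → (f · g) (suc n) ≡ f 0 * g (suc n) + (tail f · g) n
·-suc n f g = Σ<-head (suc n) (λ i → f i * g (suc n ∸ i))

·-distribʳ-+S : ∀ n (f g h : PS) → ((f +S g) · h) n ≡ (f · h) n + (g · h) n
·-distribʳ-+S n f g h =
  trans (Σ<-cong (suc n) (λ i _ → ℚ.*-distribʳ-+ (h (n ∸ i)) (f i) (g i))) (Σ<-+ (suc n) _ _)

·-distribˡ-+S : ∀ n (f g h : PS) → (f · (g +S h)) n ≡ (f · g) n + (f · h) n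
·-distribˡ-+S n f g h =
  trans (Σ<-cong (suc n) (λ i _ → ℚ.*-distribˡ-+ (f i) (g (n ∸ i)) (h (n ∸ i)))) (Σ<-+ (suc n) _ _)

⋆-·-assoc : ∀ n c (f h : PS) → ((c ⋆ f) · h) n ≡ c * (f · h) n
⋆-·-assoc n c f h = trans (Σ<-cong (suc n) (λ i _ → ℚ.*-assoc c (f i) (h (n ∸ i)))) (Σ<-*ˡ (suc n) c _)

-- The coefficient recursion ·-suc reduces associativity to the case of tail f.
·-assoc : ∀ n (f g h : PS) → ((f · g) · h) n ≡ (f · (g · h)) n
·-assoc zero f g h =
  solve 3 (λ a b c → con 0ℚ :+ (con 0ℚ :+ a :* b) :* c := con 0ℚ :+ a :* (con 0ℚ :+ b :* c)) refl (f 0) (g 0) (h 0)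
·-assoc (suc n) f g h = begin
  ((f · g) · h) (suc n)                              ≡⟨ ·-suc n (f · g) h ⟩
  fg₀ * h (suc n) + (tail (f · g) · h) n             ≡⟨ cong (_+_ (fg₀ * h (suc n))) (·-congˡ n h (λ i → ·-suc i f g)) ⟩
  fg₀ * h (suc n) + (((f 0 ⋆ tail g) +S (tail f · g)) · h) n
    ≡⟨ cong (_+_ (fg₀ * h (suc n))) (trans (·-distribʳ-+S n (f 0 ⋆ tail g) (tail f · g) h)
                                         (cong₂ _+_ (⋆-·-assoc n (f 0) (tail g) h) (·-assoc n (tail f) g h))) ⟩
  fg₀ * h (suc n) + (f 0 * (tail g · h) n + (tail f · (g · h)) n)
    ≡⟨ solve 5 (λ a b c x y → (con 0ℚ :+ a :* b) :* c :+ (a :* x :+ y) := a :* (b :* c :+ x) :+ y)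
             refl (f 0) (g 0) (h (suc n)) ((tail g · h) n) ((tail f · (g · h)) n) ⟩
  f 0 * (g 0 * h (suc n) + (tail g · h) n) + (tail f · (g · h)) n
    ≡⟨ cong (λ z → f 0 * z + (tail f · (g · h)) n) (sym (·-suc n g h)) ⟩
  f 0 * (g · h) (suc n) + (tail f · (g · h)) n      ≡⟨ sym (·-suc n f (g · h)) ⟩
  (f · (g · h)) (suc n)                              ∎
  where fg₀ = (f · g) 0

·-identityʳ : ∀ n (f : PS) → (f · oneS) n ≡ f n
·-identityʳ zero    f = trans (ℚ.+-identityˡ _) (ℚ.*-identityʳ (f 0))
·-identityʳ (suc n) f = begin
  (f · oneS) (suc n)                 ≡⟨ ·-suc n f oneS ⟩
  f 0 * 0ℚ + (tail f · oneS) n       ≡⟨ cong₂ _+_ (ℚ.*-zeroʳ (f 0)) (·-identityʳ n (tail f)) ⟩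
  0ℚ + f (suc n)                     ≡⟨ ℚ.+-identityˡ (f (suc n)) ⟩
  f (suc n)                          ∎

nth-++ˡ : ∀ (xs ys : List ℚ) j → j < length xs → nth (xs ++ ys) j ≡ nth xs j
nth-++ˡ (x ∷ xs) ys zero    _         = refl
nth-++ˡ (x ∷ xs) ys (suc j) (s≤s j<n) = nth-++ˡ xs ys j j<n

nth-++-[_] : ∀ y (xs : List ℚ) → nth (xs ++ [ y ]) (length xs) ≡ y
nth-++-[ y ] []       = refl
nth-++-[ y ] (x ∷ xs) = nth-++-[ y ] xs

length-invPrefix : ∀ c a m → length (invPrefix c a m) ≡ suc m
length-invPrefix c a zero    = refl
length-invPrefix c a (suc m) =
  trans (length-++ (invPrefix c a m)) (trans (cong (ℕ._+ 1) (length-invPrefix c a m)) (ℕ.+-comm (suc m) 1))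

nth-invPrefix : ∀ c a m j → j ≤ m → nth (invPrefix c a m) j ≡ invS c a j
nth-invPrefix c a zero    zero z≤n = refl
nth-invPrefix c a (suc m) j j≤1+m with ℕ.m≤n⇒m<n∨m≡n j≤1+m
... | inj₁ (s≤s j≤m) =
  trans (nth-++ˡ (invPrefix c a m) _ j (subst (j <_) (sym (length-invPrefix c a m)) (s≤s j≤m)))
        (nth-invPrefix c a m j j≤m)
... | inj₂ refl = refl

invS-suc : ∀ c a n → invS c a (suc n) ≡ - (c * (tail a · invS c a) n)
invS-suc c a n = begin
  invS c a (suc n)
    ≡⟨ subst (λ l → nth (invPrefix c a n ++ [ b ]) l ≡ b) (length-invPrefix c a n) (nth-++-[ b ] (invPrefix c a n)) ⟩
  b ≡⟨ cong (λ z → - (c * z)) (Σ<-cong (suc n) (λ i _ → cong (a (suc i) *_) (nth-invPrefix c a n (n ∸ i) (ℕ.m∸n≤m n i)))) ⟩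
  - (c * (tail a · invS c a) n) ∎
  where b = - (c * Σ< (suc n) (λ i → a (suc i) * nth (invPrefix c a n) (n ∸ i)))

invS-inverseʳ : ∀ c a → a 0 * c ≡ 1ℚ → ∀ n → (a · invS c a) n ≡ oneS n
invS-inverseʳ c a a₀c≡1 zero    = trans (ℚ.+-identityˡ _) a₀c≡1
invS-inverseʳ c a a₀c≡1 (suc n) = begin
  (a · invS c a) (suc n)          ≡⟨ ·-suc n a (invS c a) ⟩
  a 0 * invS c a (suc n) + s      ≡⟨ cong (λ z → a 0 * z + s) (invS-suc c a n) ⟩
  a 0 * (- (c * s)) + s           ≡⟨ cong (_+ s) (solve 3 (λ x y z → x :* (:- (y :* z)) := :- ((x :* y) :* z)) refl (a 0) c s) ⟩
  - ((a 0 * c) * s) + s           ≡⟨ cong (λ z → - (z * s) + s) a₀c≡1 ⟩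
  - (1ℚ * s) + s                  ≡⟨ solve 1 (λ x → :- (con 1ℚ :* x) :+ x := con 0ℚ) refl s ⟩
  0ℚ                              ∎
  where s = (tail a · invS c a) n

∘S-suc : ∀ n (f g : PS) → f 0 ≡ 0ℚ → (f ∘S g) (suc n) ≡ Σ< (suc n) (λ m → f (suc m) * (g ^S suc m) (suc n))
∘S-suc n f g f₀≡0 = begin
  (f ∘S g) (suc n)                          ≡⟨ Σ<-head (suc n) _ ⟩
  f 0 * (g ^S 0) (suc n) + rest             ≡⟨ cong (λ z → z * 0ℚ + rest) f₀≡0 ⟩
  0ℚ * 0ℚ + rest                            ≡⟨ ℚ.+-identityˡ rest ⟩
  rest                                      ∎
  where rest = Σ< (suc n) (λ m → f (suc m) * (g ^S suc m) (suc n))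

1^ℚ : ∀ j → ℕ→ℚ 1 ^ℚ j ≡ 1ℚ
1^ℚ zero    = refl
1^ℚ (suc j) = trans (ℚ.*-identityˡ _) (1^ℚ j)

expS-1+expS-0 : ∀ i → (expS (ℕ→ℚ 1) +S expS 0ℚ) i ≡ expPlusOne i
expS-1+expS-0 zero    = refl
expS-1+expS-0 (suc j) = begin
  (ℕ→ℚ 1 * (ℕ→ℚ 1 ^ℚ j)) * inv! (suc j) + (0ℚ * (0ℚ ^ℚ j)) * inv! (suc j)
    ≡⟨ cong₂ _+_ (cong (_* inv! (suc j)) (1^ℚ (suc j)))
                 (trans (cong (_* inv! (suc j)) (ℚ.*-zeroˡ (0ℚ ^ℚ j))) (ℚ.*-zeroˡ (inv! (suc j)))) ⟩
  1ℚ * inv! (suc j) + 0ℚ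
    ≡⟨ trans (ℚ.+-identityʳ _) (ℚ.*-identityˡ (inv! (suc j))) ⟩
  inv! (suc j) ∎

genG-1+genG-0 : ∀ k n → genG k (ℕ→ℚ 1) n + genG k 0ℚ n ≡ (ℕ→ℚ 2 ⋆ (Ei k ∘S logS)) n
genG-1+genG-0 k n = begin
  genG k (ℕ→ℚ 1) n + genG k 0ℚ n             ≡⟨ sym (·-distribʳ-+S n (A · expS (ℕ→ℚ 1)) (A · expS 0ℚ) I) ⟩
  (((A · expS (ℕ→ℚ 1)) +S (A · expS 0ℚ)) · I) n
    ≡⟨ ·-congˡ n I (λ i → trans (sym (·-distribˡ-+S i A (expS (ℕ→ℚ 1)) (expS 0ℚ))) (·-congʳ i A expS-1+expS-0)) ⟩
  ((A · expPlusOne) · I) n                   ≡⟨ ·-assoc n A expPlusOne I ⟩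
  (A · (expPlusOne · I)) n                   ≡⟨ ·-congʳ n A (invS-inverseʳ (inv-suc 1) expPlusOne refl) ⟩
  (A · oneS) n                               ≡⟨ ·-identityʳ n A ⟩
  A n                                        ∎
  where
  A = ℕ→ℚ 2 ⋆ (Ei k ∘S logS)
  I = invS (inv-suc 1) expPlusOne

S₁-term : ∀ k n m → zpow-suc m (+ 1 - k) * S₁ (suc n) (suc m)
                    ≡ ℕ→ℚ (suc n !) * (Ei k (suc m) * (logS ^S suc m) (suc n))
S₁-term k n m = begin
  z * (N * (L * inv! (suc m)))   ≡⟨ solve 4 (λ a b c d → a :* (b :* (c :* d)) := b :* ((a :* d) :* c)) refl z N L (inv! (suc m)) ⟩
  N * ((z * inv! (suc m)) * L)   ≡⟨ cong (λ w → N * (w * L)) (zpow-suc-1+-*-inv! m (ℤ.- k)) ⟩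
  N * (Ei k (suc m) * L)         ∎
  where
  z = zpow-suc m (+ 1 - k)
  N = ℕ→ℚ (suc n !)
  L = (logS ^S suc m) (suc n)

corollary2 : (k : ℤ) (n : ℕ) →
    (ℕ→ℚ 2 * inv-suc n) * Σ< (suc n) (λ m → zpow-suc m (+ 1 - k) * S₁ (suc n) (suc m))
      ≡ E k n (ℕ→ℚ 1) + E k n 0ℚ
corollary2 k n = begin
  (two * r) * Σ< (suc n) (λ m → zpow-suc m (+ 1 - k) * S₁ (suc n) (suc m))
    ≡⟨ cong ((two * r) *_) (Σ<-cong (suc n) (λ m _ → S₁-term k n m)) ⟩
  (two * r) * Σ< (suc n) (λ m → N * (Ei k (suc m) * (logS ^S suc m) (suc n)))
    ≡⟨ cong ((two * r) *_) (trans (Σ<-*ˡ (suc n) N _) (cong (N *_) (sym (∘S-suc n (Ei k) logS refl)))) ⟩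
  (two * r) * (N * (Ei k ∘S logS) (suc n))
    ≡⟨ solve 4 (λ a b c d → (a :* b) :* (c :* d) := (c :* (a :* d)) :* b) refl two r N ((Ei k ∘S logS) (suc n)) ⟩
  (N * (ℕ→ℚ 2 ⋆ (Ei k ∘S logS)) (suc n)) * r
    ≡⟨ cong (λ w → (N * w) * r) (sym (genG-1+genG-0 k (suc n))) ⟩
  (N * (g₁ + g₀)) * r
    ≡⟨ solve 4 (λ a b c d → (a :* (b :+ c)) :* d := (a :* b) :* d :+ (a :* c) :* d) refl N g₁ g₀ r ⟩
  E k n (ℕ→ℚ 1) + E k n 0ℚ ∎
  where
  two = ℕ→ℚ 2
  r = inv-suc n
  N = ℕ→ℚ (suc n !)
  g₁ = genG k (ℕ→ℚ 1) (suc n)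
  g₀ = genG k 0ℚ (suc n)
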